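{- Let $m$ and $n$ be integers with $m\ge 3$ and $n\ge 3$. Then $\mathrm{SG}(n^m)=0$ if $m+n$ is even and $\mathrm{SG}(n^m)=1$ if $m+n$ is odd.
   Context: $(n^m)$ denotes the rectangular partition with $m$ parts equal to $n$. LCTR: positions are partitions; from nonempty $\lambda=(\lambda_1,\dots,\lambda_k)$ one may move to $T(\lambda)=(\lambda_2,\dots,\lambda_k)$ or $L(\lambda)=(\lambda_1-1,\dots,\lambda_k-1)$ (nonpositive entries omitted); $()$ has no moves. $\mathrm{SG}(())=0$, $\mathrm{SG}(\lambda)=\mathrm{mex}\{\mathrm{SG}(L(\lambda)),\mathrm{SG}(T(\lambda))\}$ otherwise, with $\mathrm{mex}(B)$ the least nonnegative integer not in $B$. -}

module Defs where

open import Data.Nat using (ℕ; zero; suc; _+_; _∸_)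
open import Data.List using (List; []; _∷_; replicate)
open import Data.Nat.ListAction using (sum)

-- A partition is a (weakly decreasing) list of positive naturals.
Partition : Set
Partition = List ℕ

T : Partition → Partition
T []       = []
T (_ ∷ xs) = xs

L : Partition → Partition
L []            = []
L (zero ∷ xs)   = L xs
L (suc a ∷ xs)  = dropZero a (L xs)
  where
  dropZero : ℕ → Partition → Partition
  dropZero zero    ys = ys
  dropZero (suc b) ys = suc b ∷ ys

mex2 : ℕ → ℕ → ℕ
mex2 zero (suc zero) = 2
mex2 (suc zero) zero = 2
mex2 zero _          = 1
mex2 _    zero       = 1
mex2 _    _          = 0

-- SG computed with a fuel parameter; every move removes at least one cell,
-- so fuel = number of cells (sum of parts) suffices.
SG-fuel : ℕ → Partition → ℕ
SG-fuel _        []       = 0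
SG-fuel zero     (_ ∷ _)  = 0
SG-fuel (suc f)  (x ∷ xs) = mex2 (SG-fuel f (L (x ∷ xs))) (SG-fuel f (T (x ∷ xs)))

SG : Partition → ℕ
SG λ′ = SG-fuel (sum λ′) λ′

rect : ℕ → ℕ → Partition
rect n m = replicate m n

-- On a rectangle every move again gives a rectangle (possibly empty): T drops a
-- row and L shortens every row.  So SG(n^m) obeys the grid recursion
-- g(n,m) = mex{g(n-1,m), g(n,m-1)} with g = 0 on the axes.  Rows 1 and 2 of
-- the grid are 2-periodic with explicit values; row 2 determines row 3, and
-- symmetry g(n,m) = g(m,n) gives column 3.  Beyond that the grid is the
-- parity of n + m, since when both neighbours carry the same bit p the mex
-- is the opposite bit.
module Submission where

open import Defs
open import Data.Nat using (ℕ; zero; suc; _+_; _*_; _≥_; _≤_; _%_; s≤s)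
open import Data.Nat.Properties using (+-suc; +-comm; +-commutativeSemigroup; +-identityʳ; +-monoʳ-≤; *-monoʳ-≤; n≤1+n; m≤n+m; ≤-trans; ≤-reflexive)
open import Data.Nat.ListAction using (sum)
open import Data.List using ([]; _∷_)
open import Data.Product using (_×_; _,_)
open import Relation.Binary.PropositionalEquality using (_≡_; refl; sym; trans; cong; cong₂; module ≡-Reasoning)
open ≡-Reasoning
open import Algebra.Properties.CommutativeSemigroup +-commutativeSemigroup using (x∙yz≈y∙xz)

mex2-comm : ∀ a b → mex2 a b ≡ mex2 b a
mex2-comm zero          zero          = refl
mex2-comm zero          (suc zero)    = refl
mex2-comm zero          (suc (suc b)) = refl
mex2-comm (suc zero)    zero          = refl
mex2-comm (suc zero)    (suc zero)    = refl
mex2-comm (suc zero)    (suc (suc b)) = refl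
mex2-comm (suc (suc a)) zero          = refl
mex2-comm (suc (suc a)) (suc zero)    = refl
mex2-comm (suc (suc a)) (suc (suc b)) = refl

gridSG : ℕ → ℕ → ℕ
gridSG zero    m       = 0
gridSG (suc n) zero    = 0
gridSG (suc n) (suc m) = mex2 (gridSG n (suc m)) (gridSG (suc n) m)

gridSG-comm : ∀ n m → gridSG n m ≡ gridSG m n
gridSG-comm zero    zero    = refl
gridSG-comm zero    (suc m) = refl
gridSG-comm (suc n) zero    = refl
gridSG-comm (suc n) (suc m) = begin
  mex2 (gridSG n (suc m)) (gridSG (suc n) m)
    ≡⟨ cong₂ mex2 (gridSG-comm n (suc m)) (gridSG-comm (suc n) m) ⟩
  mex2 (gridSG (suc m) n) (gridSG m (suc n))
    ≡⟨ mex2-comm (gridSG (suc m) n) (gridSG m (suc n)) ⟩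
  mex2 (gridSG m (suc n)) (gridSG (suc m) n)
    ∎

mex2-zero-parity : ∀ k → mex2 0 (suc (k % 2)) ≡ suc (suc k % 2)
mex2-zero-parity zero          = refl
mex2-zero-parity (suc zero)    = refl
mex2-zero-parity (suc (suc k)) = mex2-zero-parity k

mex2-row₂-parity : ∀ k → mex2 (suc (suc k % 2)) (2 * (suc k % 2)) ≡ 2 * (k % 2)
mex2-row₂-parity zero          = refl
mex2-row₂-parity (suc zero)    = refl
mex2-row₂-parity (suc (suc k)) = mex2-row₂-parity k

mex2-corner-parity : ∀ k → mex2 (2 * (k % 2)) (k % 2) ≡ suc k % 2
mex2-corner-parity zero          = refl
mex2-corner-parity (suc zero)    = refl
mex2-corner-parity (suc (suc k)) = mex2-corner-parity k

mex2-diag-parity : ∀ k → mex2 (k % 2) (k % 2) ≡ suc k % 2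
mex2-diag-parity zero          = refl
mex2-diag-parity (suc zero)    = refl
mex2-diag-parity (suc (suc k)) = mex2-diag-parity k

gridSG-row₁ : ∀ m → gridSG 1 (suc m) ≡ suc (m % 2)
gridSG-row₁ zero    = refl
gridSG-row₁ (suc m) = trans (cong (mex2 0) (gridSG-row₁ m)) (mex2-zero-parity m)

gridSG-row₂ : ∀ m → gridSG 2 (suc m) ≡ 2 * (suc m % 2)
gridSG-row₂ zero    = refl
gridSG-row₂ (suc m) =
  trans (cong₂ mex2 (gridSG-row₁ (suc m)) (gridSG-row₂ m)) (mex2-row₂-parity m)

gridSG-row₃ : ∀ b → gridSG 3 (3 + b) ≡ b % 2
gridSG-row₃ zero    = refl
gridSG-row₃ (suc b) =
  trans (cong₂ mex2 (gridSG-row₂ (3 + b)) (gridSG-row₃ b)) (mex2-corner-parity b)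

gridSG-≥3 : ∀ a b → gridSG (3 + a) (3 + b) ≡ (a + b) % 2
gridSG-≥3 zero    b       = gridSG-row₃ b
gridSG-≥3 (suc a) zero    = begin
  gridSG (4 + a) 3 ≡⟨ gridSG-comm (4 + a) 3 ⟩
  gridSG 3 (4 + a) ≡⟨ gridSG-row₃ (suc a) ⟩
  suc a % 2        ≡⟨ cong (_% 2) (sym (+-identityʳ (suc a))) ⟩
  (suc a + 0) % 2  ∎
gridSG-≥3 (suc a) (suc b) = begin
  mex2 (gridSG (3 + a) (4 + b)) (gridSG (4 + a) (3 + b))
    ≡⟨ cong₂ mex2 (gridSG-≥3 a (suc b)) (gridSG-≥3 (suc a) b) ⟩
  mex2 ((a + suc b) % 2) (suc (a + b) % 2)
    ≡⟨ cong (λ k → mex2 (k % 2) (suc (a + b) % 2)) (+-suc a b) ⟩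
  mex2 (suc (a + b) % 2) (suc (a + b) % 2)
    ≡⟨ mex2-diag-parity (suc (a + b)) ⟩
  (a + b) % 2
    ≡⟨ cong (λ k → suc k % 2) (sym (+-suc a b)) ⟩
  (suc a + suc b) % 2
    ∎

-- rect n m with its zero parts dropped: rect 0 m consists of m zeros, whereas
-- L produces the empty partition.
rect⁺ : ℕ → ℕ → Partition
rect⁺ zero    m = []
rect⁺ (suc n) m = rect (suc n) m

L-rect : ∀ n m → L (rect (suc n) m) ≡ rect⁺ n m
L-rect zero    zero    = refl
L-rect (suc n) zero    = refl
L-rect zero    (suc m) = L-rect zero m
L-rect (suc n) (suc m) = cong (suc n ∷_) (L-rect (suc n) m)

sum-rect : ∀ n m → sum (rect n m) ≡ m * n
sum-rect n zero    = refl
sum-rect n (suc m) = cong (n +_) (sum-rect n m)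

SG-fuel-rect⁺ : ∀ f n m → m * n ≤ f → SG-fuel f (rect⁺ n m) ≡ gridSG n m
SG-fuel-rect⁺ f       zero    m       _ = refl
SG-fuel-rect⁺ f       (suc n) zero    _ = refl
SG-fuel-rect⁺ (suc f) (suc n) (suc m) (s≤s m*n≤f) =
  cong₂ mex2
    (trans (cong (SG-fuel f) (L-rect n (suc m))) (SG-fuel-rect⁺ f n (suc m) shorter≤f))
    (SG-fuel-rect⁺ f (suc n) m (≤-trans (m≤n+m (m * suc n) n) m*n≤f))
  where
  shorter≤f : suc m * n ≤ f
  shorter≤f = ≤-trans (+-monoʳ-≤ n (*-monoʳ-≤ m (n≤1+n n))) m*n≤f

SG-rect : ∀ n m → SG (rect (suc n) m) ≡ gridSG (suc n) m
SG-rect n m = SG-fuel-rect⁺ (sum (rect (suc n) m)) (suc n) m (≤-reflexive (sym (sum-rect (suc n) m)))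

lemma3p7 : (m n : ℕ) → m ≥ 3 → n ≥ 3 →
    ((m + n) % 2 ≡ 0 → SG (rect n m) ≡ 0) ×
    ((m + n) % 2 ≡ 1 → SG (rect n m) ≡ 1)
lemma3p7 (suc (suc (suc a))) (suc (suc (suc b))) (s≤s (s≤s (s≤s _))) (s≤s (s≤s (s≤s _))) =
  (λ even → trans SG≡parity even) , (λ odd → trans SG≡parity odd)
  where
  SG≡parity : SG (rect (3 + b) (3 + a)) ≡ (3 + a + (3 + b)) % 2
  SG≡parity = begin
    SG (rect (3 + b) (3 + a))  ≡⟨ SG-rect (2 + b) (3 + a) ⟩
    gridSG (3 + b) (3 + a)     ≡⟨ gridSG-≥3 b a ⟩
    (b + a) % 2                ≡⟨ cong (_% 2) (+-comm b a) ⟩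
    (6 + (a + b)) % 2          ≡⟨ cong (λ k → (3 + k) % 2) (sym (x∙yz≈y∙xz a 3 b)) ⟩
    (3 + a + (3 + b)) % 2      ∎
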